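{- Let $\mathrm{le}=(\mathrm{le}(n))_{n\ge0}$ be Leech's word, the fixed point starting with $0$ of the morphism $0\mapsto 0,1,2,1,0,2,1,2,0,1,2,1,0$; $1\mapsto 1,2,0,2,1,0,2,0,1,2,0,2,1$; $2\mapsto 2,0,1,0,2,1,0,1,2,0,1,0,2$, and let $\mathrm{sum}_{\mathrm{le}}(n)=\sum_{i=0}^{n}\mathrm{le}(i)$ (values summed as integers). Then for every integer $r\ge0$, with $n=(13^{3r}-1)/12$, we have $\mathrm{sum}_{\mathrm{le}}(n)=n+3r$. -}

module Defs where

open import Data.Nat using (ℕ; zero; suc; _+_; _*_; _∸_; _^_)
open import Data.Nat.DivMod using (_/_; _%_)
open import Data.Fin using (Fin; zero; suc; toℕ)
open import Data.Vec using (Vec; []; _∷_; lookup)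

σ : Fin 3 → Vec ℕ 13
σ zero             = 0 ∷ 1 ∷ 2 ∷ 1 ∷ 0 ∷ 2 ∷ 1 ∷ 2 ∷ 0 ∷ 1 ∷ 2 ∷ 1 ∷ 0 ∷ []
σ (suc zero)       = 1 ∷ 2 ∷ 0 ∷ 2 ∷ 1 ∷ 0 ∷ 2 ∷ 0 ∷ 1 ∷ 2 ∷ 0 ∷ 2 ∷ 1 ∷ []
σ (suc (suc zero)) = 2 ∷ 0 ∷ 1 ∷ 0 ∷ 2 ∷ 1 ∷ 0 ∷ 1 ∷ 2 ∷ 0 ∷ 1 ∷ 0 ∷ 2 ∷ []

toLetter : ℕ → Fin 3
toLetter 0 = zero
toLetter 1 = suc zero
toLetter _ = suc (suc zero)

-- The fixed point of σ starting with 0 satisfies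
--   le(0) = 0,  le(13 q + j) = σ(le(q))_j   (0 ≤ j < 13).
-- We compute it by recursion on n/13 with fuel; fuel ≥ n suffices since n/13 < n for n ≥ 1.
leFuel : ℕ → ℕ → ℕ
leFuel zero     n = 0
leFuel (suc f)  zero = 0
leFuel (suc f)  n@(suc _) = lookup (σ (toLetter (leFuel f (n / 13)))) (Data.Fin.fromℕ< (Data.Nat.DivMod.m%n<n n 13))

le : ℕ → ℕ
le n = leFuel n n

sumLe : ℕ → ℕ
sumLe zero    = le 0
sumLe (suc n) = sumLe n + le (suc n)

{-# OPTIONS --safe #-}
module Submission where

-- Write a ⊖ s for the letter a read relative to s, i.e. (a − s) mod 3.  Every image σ(a) is σ(0)
-- with all letters shifted by a, and σ(0) contains four 0s, five 1s and four 2s, so summing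
-- (x ⊖ (s + 1)) over the letters x of σ(a) gives 12 + (a ⊖ s).  Cutting the prefix of length 13q
-- into q blocks σ(le i) therefore gives W_{s+1}(13q) = 12q + W_s(q), where
-- W_s(m) = Σ_{i<m} (le(i) ⊖ s).  Along the base-13 repunits N_k = (13^k − 1)/12, which satisfy
-- N_{k+1} = 13 N_k + 1, this yields le(N_k) = k mod 3 and W_{k mod 3}(N_k) = N_k + k.  For k = 3r
-- the shift is 0, so sum_le(N_k) = W_0(N_k) + le(N_k) = N_k + 3r.

open import Defs
open import Data.Nat using (ℕ; zero; suc; _+_; _*_; _∸_; _^_; _≤_; _<_; z≤n; s≤s; s≤s⁻¹)
open import Data.Nat.Properties using (≤-refl; ≤-trans; m≤n⇒m≤1+n; +-identityʳ; +-assoc; *-suc)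
open import Data.Nat.DivMod
  using (_/_; _%_; m%n<n; m/n<m; m%n%n≡m%n; [m+kn]%n≡m%n; m<n⇒m%n≡m; m<n⇒m/n≡0; m*n/n≡m; +-distrib-/-∣ʳ)
open import Data.Nat.Divisibility using (divides-refl)
open import Data.Fin using (Fin; zero; suc; toℕ; fromℕ<)
open import Data.Fin.Properties using (fromℕ<-cong)
open import Data.Vec using (lookup)
open import Data.Vec.Relation.Unary.All using (All; _∷_; [])
open import Data.Vec.Relation.Unary.All.Properties using (lookup⁺)
open import Relation.Binary.PropositionalEquality using (_≡_; refl; sym; trans; cong; cong₂; module ≡-Reasoning)
open import Data.Nat.Solver using (module +-*-Solver)
open +-*-Solver using (solve; _:=_; con; _:+_; _:*_)

[1+n]/13≤n : ∀ n → suc n / 13 ≤ n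
[1+n]/13≤n n = s≤s⁻¹ (m/n<m (suc n) 13 (s≤s (s≤s z≤n)))

leFuel-irrelevant : ∀ f g n → n ≤ f → n ≤ g → leFuel f n ≡ leFuel g n
leFuel-irrelevant zero    zero    zero    _       _       = refl
leFuel-irrelevant zero    (suc g) zero    _       _       = refl
leFuel-irrelevant (suc f) zero    zero    _       _       = refl
leFuel-irrelevant (suc f) (suc g) zero    _       _       = refl
leFuel-irrelevant (suc f) (suc g) (suc n) (s≤s n≤f) (s≤s n≤g) =
  cong (λ x → lookup (σ (toLetter x)) (fromℕ< (m%n<n (suc n) 13)))
       (leFuel-irrelevant f g (suc n / 13) (≤-trans ([1+n]/13≤n n) n≤f) (≤-trans ([1+n]/13≤n n) n≤g))

letter : ℕ → Fin 3
letter n = toLetter (le n)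

le-unfold : ∀ n → le n ≡ lookup (σ (letter (n / 13))) (fromℕ< (m%n<n n 13))
le-unfold zero    = refl
le-unfold (suc n) =
  cong (λ x → lookup (σ (toLetter x)) (fromℕ< (m%n<n (suc n) 13)))
       (leFuel-irrelevant n (suc n / 13) (suc n / 13) ([1+n]/13≤n n) ≤-refl)

IsLetter : ℕ → Set
IsLetter x = toℕ (toLetter x) ≡ x

σ-letters : ∀ a → All IsLetter (σ a)
σ-letters zero             = refl ∷ refl ∷ refl ∷ refl ∷ refl ∷ refl ∷ refl ∷ refl ∷ refl ∷ refl ∷ refl ∷ refl ∷ refl ∷ []
σ-letters (suc zero)       = refl ∷ refl ∷ refl ∷ refl ∷ refl ∷ refl ∷ refl ∷ refl ∷ refl ∷ refl ∷ refl ∷ refl ∷ refl ∷ []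
σ-letters (suc (suc zero)) = refl ∷ refl ∷ refl ∷ refl ∷ refl ∷ refl ∷ refl ∷ refl ∷ refl ∷ refl ∷ refl ∷ refl ∷ refl ∷ []

toℕ-letter : ∀ n → toℕ (letter n) ≡ le n
toℕ-letter zero = refl
toℕ-letter n@(suc _) rewrite le-unfold n = lookup⁺ (σ-letters (letter (n / 13))) (fromℕ< (m%n<n n 13))

σ-letter : Fin 3 → ℕ → Fin 3
σ-letter a j = toLetter (lookup (σ a) (fromℕ< (m%n<n j 13)))

letter-unfold : ∀ n → letter n ≡ σ-letter (letter (n / 13)) (n % 13)
letter-unfold n = trans (cong toLetter (le-unfold n))
  (cong (λ i → toLetter (lookup (σ (letter (n / 13))) i))
        (fromℕ<-cong _ _ (sym (m%n%n≡m%n n 13)) _ _))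

letter-block : ∀ q j → j < 13 → letter (j + q * 13) ≡ σ-letter (letter q) j
letter-block q j j<13 = trans (letter-unfold (j + q * 13)) (cong₂ (λ i k → σ-letter (letter i) k) quotient remainder)
  where
  remainder : (j + q * 13) % 13 ≡ j
  remainder = trans ([m+kn]%n≡m%n j q 13) (m<n⇒m%n≡m j<13)
  quotient : (j + q * 13) / 13 ≡ q
  quotient = trans (+-distrib-/-∣ʳ j (divides-refl q)) (cong₂ _+_ (m<n⇒m/n≡0 j<13) (m*n/n≡m q 13))

rot : Fin 3 → Fin 3
rot zero             = suc zero
rot (suc zero)       = suc (suc zero)
rot (suc (suc zero)) = zero

_⊖_ : Fin 3 → Fin 3 → ℕ
a ⊖ zero           = toℕ a
a ⊖ suc zero       = toℕ (rot (rot a))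
a ⊖ suc (suc zero) = toℕ (rot a)

σ-letter-0 : ∀ a → σ-letter a 0 ≡ a
σ-letter-0 zero             = refl
σ-letter-0 (suc zero)       = refl
σ-letter-0 (suc (suc zero)) = refl

σ-letter-1 : ∀ a → σ-letter a 1 ≡ rot a
σ-letter-1 zero             = refl
σ-letter-1 (suc zero)       = refl
σ-letter-1 (suc (suc zero)) = refl

⊖-rot : ∀ s → s ⊖ rot s ≡ 2
⊖-rot zero             = refl
⊖-rot (suc zero)       = refl
⊖-rot (suc (suc zero)) = refl

sumBelow : (ℕ → ℕ) → ℕ → ℕ
sumBelow f zero    = 0
sumBelow f (suc n) = sumBelow f n + f n

sumBelow-+ : ∀ f n m → sumBelow f (n + m) ≡ sumBelow f m + sumBelow (λ j → f (j + m)) n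
sumBelow-+ f zero    m = sym (+-identityʳ _)
sumBelow-+ f (suc n) m = trans (cong (_+ f (n + m)) (sumBelow-+ f n m)) (+-assoc (sumBelow f m) _ _)

sumBelow-cong : ∀ {f g} n → (∀ j → j < n → f j ≡ g j) → sumBelow f n ≡ sumBelow g n
sumBelow-cong zero    f≗g = refl
sumBelow-cong (suc n) f≗g = cong₂ _+_ (sumBelow-cong n (λ j j<n → f≗g j (m≤n⇒m≤1+n j<n))) (f≗g n ≤-refl)

σ-shiftedSum : ∀ s a → sumBelow (λ j → σ-letter a j ⊖ rot s) 13 ≡ 12 + a ⊖ s
σ-shiftedSum zero             zero             = refl
σ-shiftedSum zero             (suc zero)       = refl
σ-shiftedSum zero             (suc (suc zero)) = refl
σ-shiftedSum (suc zero)       zero             = refl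
σ-shiftedSum (suc zero)       (suc zero)       = refl
σ-shiftedSum (suc zero)       (suc (suc zero)) = refl
σ-shiftedSum (suc (suc zero)) zero             = refl
σ-shiftedSum (suc (suc zero)) (suc zero)       = refl
σ-shiftedSum (suc (suc zero)) (suc (suc zero)) = refl

shiftedSum : Fin 3 → ℕ → ℕ
shiftedSum s = sumBelow (λ i → letter i ⊖ s)

shiftedSum-*13 : ∀ s q → shiftedSum (rot s) (q * 13) ≡ q * 12 + shiftedSum s q
shiftedSum-*13 s zero    = refl
shiftedSum-*13 s (suc q) = begin
    shiftedSum (rot s) (13 + q * 13)
  ≡⟨ sumBelow-+ (λ i → letter i ⊖ rot s) 13 (q * 13) ⟩
    shiftedSum (rot s) (q * 13) + sumBelow (λ j → letter (j + q * 13) ⊖ rot s) 13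
  ≡⟨ cong₂ _+_ (shiftedSum-*13 s q) lastBlock ⟩
    (q * 12 + shiftedSum s q) + (12 + letter q ⊖ s)
  ≡⟨ solve 3 (λ a b c → (a :+ b) :+ (con 12 :+ c) := (con 12 :+ a) :+ (b :+ c))
           refl (q * 12) (shiftedSum s q) (letter q ⊖ s) ⟩
    (12 + q * 12) + (shiftedSum s q + letter q ⊖ s)
  ∎
  where
  open ≡-Reasoning
  lastBlock : sumBelow (λ j → letter (j + q * 13) ⊖ rot s) 13 ≡ 12 + letter q ⊖ s
  lastBlock = trans (sumBelow-cong 13 (λ j j<13 → cong (_⊖ rot s) (letter-block q j j<13)))
                    (σ-shiftedSum s (letter q))

repunit : ℕ → ℕ
repunit zero    = 0
repunit (suc k) = suc (repunit k * 13)

13^≡1+repunit*12 : ∀ k → 13 ^ k ≡ suc (repunit k * 12)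
13^≡1+repunit*12 zero    = refl
13^≡1+repunit*12 (suc k) rewrite 13^≡1+repunit*12 k =
  solve 1 (λ n → con 13 :* (con 1 :+ n :* con 12) := con 1 :+ (con 1 :+ n :* con 13) :* con 12) refl (repunit k)

[13^k∸1]/12≡repunit : ∀ k → (13 ^ k ∸ 1) / 12 ≡ repunit k
[13^k∸1]/12≡repunit k = trans (cong (λ x → (x ∸ 1) / 12) (13^≡1+repunit*12 k)) (m*n/n≡m (repunit k) 12)

_mod3 : ℕ → Fin 3
zero  mod3 = zero
suc k mod3 = rot (k mod3)

rot³≡id : ∀ a → rot (rot (rot a)) ≡ a
rot³≡id zero             = refl
rot³≡id (suc zero)       = refl
rot³≡id (suc (suc zero)) = refl

[3*r]mod3≡0 : ∀ r → (3 * r) mod3 ≡ zero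
[3*r]mod3≡0 zero    = refl
[3*r]mod3≡0 (suc r) = begin
    (3 * suc r) mod3                ≡⟨ cong _mod3 (*-suc 3 r) ⟩
    rot (rot (rot ((3 * r) mod3)))  ≡⟨ rot³≡id _ ⟩
    (3 * r) mod3                    ≡⟨ [3*r]mod3≡0 r ⟩
    zero                            ∎
  where open ≡-Reasoning

letter-repunit : ∀ k → letter (repunit k) ≡ k mod3
letter-repunit zero    = refl
letter-repunit (suc k) = begin
    letter (1 + repunit k * 13)      ≡⟨ letter-block (repunit k) 1 (s≤s (s≤s z≤n)) ⟩
    σ-letter (letter (repunit k)) 1  ≡⟨ σ-letter-1 _ ⟩
    rot (letter (repunit k))         ≡⟨ cong rot (letter-repunit k) ⟩
    rot (k mod3)                     ∎
  where open ≡-Reasoning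

shiftedSum-repunit : ∀ k → shiftedSum (k mod3) (repunit k) ≡ repunit k + k
shiftedSum-repunit zero    = refl
shiftedSum-repunit (suc k) = begin
    shiftedSum (rot s) (n * 13) + letter (n * 13) ⊖ rot s
  ≡⟨ cong₂ _+_ (shiftedSum-*13 s n) (cong (_⊖ rot s) lastLetter) ⟩
    (n * 12 + shiftedSum s n) + s ⊖ rot s
  ≡⟨ cong₂ (λ x y → (n * 12 + x) + y) (shiftedSum-repunit k) (⊖-rot s) ⟩
    (n * 12 + (n + k)) + 2
  ≡⟨ solve 2 (λ n k → (n :* con 12 :+ (n :+ k)) :+ con 2 := (con 1 :+ n :* con 13) :+ (con 1 :+ k)) refl n k ⟩
    suc (n * 13) + suc k
  ∎
  where
  open ≡-Reasoning
  n = repunit k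
  s = k mod3
  lastLetter : letter (n * 13) ≡ s
  lastLetter = trans (letter-block n 0 (s≤s z≤n)) (trans (σ-letter-0 _) (letter-repunit k))

sumLe≡shiftedSum : ∀ n → sumLe n ≡ shiftedSum zero (suc n)
sumLe≡shiftedSum zero    = sym (toℕ-letter 0)
sumLe≡shiftedSum (suc n) = cong₂ _+_ (sumLe≡shiftedSum n) (sym (toℕ-letter (suc n)))

mainTheorem16 : (r : ℕ) → sumLe ((13 ^ (3 * r) ∸ 1) / 12) ≡ (13 ^ (3 * r) ∸ 1) / 12 + 3 * r
mainTheorem16 r rewrite [13^k∸1]/12≡repunit (3 * r) = begin
    sumLe n
  ≡⟨ sumLe≡shiftedSum n ⟩
    shiftedSum zero n + letter n ⊖ zero
  ≡⟨ cong₂ _+_ (cong (λ s → shiftedSum s n) (sym shift≡0)) (cong toℕ (trans (letter-repunit k) shift≡0)) ⟩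
    shiftedSum (k mod3) n + 0
  ≡⟨ trans (+-identityʳ _) (shiftedSum-repunit k) ⟩
    n + k
  ∎
  where
  open ≡-Reasoning
  k = 3 * r
  n = repunit k
  shift≡0 : k mod3 ≡ zero
  shift≡0 = [3*r]mod3≡0 r
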